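{- Let $k\ge 2$ be an integer. Then $C_k = A_1\cup A_2\cup A_3\cup A_4\cup A_5$, where (1) $A_1=\{2x : x\in C_{k-1},\ x \text{ even}\}$; (2) $A_2=\{3x : x\in C_{k-1},\ x\text{ odd}\}$; (3) $A_3=\{px : 2\le k_1\le k-1,\ x\in C_{k-k_1},\ p\in Q_{k_1+1}\}$; (4) $A_4=\{m+1 : m\in C_{k-1},\ m \text{ even},\ m+1 \text{ prime}\}$; (5) $A_5=\{2y : y\in A_1\cup A_2\cup A_3\cup A_4,\ y\text{ odd}\}$.
   Context: Let $\varphi$ be Euler's totient function. The height function $H:\mathbb{Z}_{>0}\to\mathbb{Z}_{\ge 0}$ is defined by $H(1)=0$ and $H(n)=H(\varphi(n))+1$ for $n\ge 2$ (equivalently, for $n>1$, $H(n)$ is the least $i$ with the $i$-th iterate of $\varphi$ at $n$ equal to $1$). For $k\ge 0$ let $C_k=\{n\ge 1 : H(n)=k\}$, and for $k\ge 1$ let $Q_k=\{p \text{ prime} : H(p)=k\}$. -}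

module Defs where

open import Data.Nat using (ℕ; zero; suc; _+_; _*_; _∸_; _≤_)
open import Data.Nat.Coprimality using (coprime?)
open import Data.Nat.Primality using (Prime)
open import Data.Nat.Properties using ()
open import Data.List using (List; length; filter; map; upTo)
open import Data.Product using (Σ; _×_; ∃-syntax)
open import Data.Sum using (_⊎_)
open import Data.Nat.Divisibility using (_∣_)
open import Relation.Nullary using (¬_)
open import Relation.Binary.PropositionalEquality using (_≡_)

φ : ℕ → ℕ
φ n = length (filter (λ i → coprime? i n) (map suc (upTo n)))

data HasHeight : ℕ → ℕ → Set where
  h-one  : HasHeight 1 0
  h-step : ∀ {n k} → 2 ≤ n → HasHeight (φ n) k → HasHeight n (suc k)

Even : ℕ → Set
Even x = 2 ∣ x

Odd : ℕ → Set
Odd x = ¬ (2 ∣ x)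

C : ℕ → ℕ → Set
C k n = HasHeight n k

Q : ℕ → ℕ → Set
Q k p = Prime p × HasHeight p k

A₁ : ℕ → ℕ → Set
A₁ k n = ∃[ x ] (C (k ∸ 1) x × Even x × n ≡ 2 * x)

A₂ : ℕ → ℕ → Set
A₂ k n = ∃[ x ] (C (k ∸ 1) x × Odd x × n ≡ 3 * x)

A₃ : ℕ → ℕ → Set
A₃ k n = ∃[ k₁ ] ∃[ x ] ∃[ p ]
  (2 ≤ k₁ × k₁ ≤ k ∸ 1 × C (k ∸ k₁) x × Q (k₁ + 1) p × n ≡ p * x)

A₄ : ℕ → ℕ → Set
A₄ k n = ∃[ m ] (C (k ∸ 1) m × Even m × Prime (m + 1) × n ≡ m + 1)

A₁₋₄ : ℕ → ℕ → Set
A₁₋₄ k y = A₁ k y ⊎ A₂ k y ⊎ A₃ k y ⊎ A₄ k y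

A₅ : ℕ → ℕ → Set
A₅ k n = ∃[ y ] (A₁₋₄ k y × Odd y × n ≡ 2 * y)

{-# OPTIONS --safe #-}

-- Following Shapiro, let class n be H(n) for even n and H(n) − 1 for odd n (class 1 = 0).
-- Since φ(n) is even for n ≥ 3, class (φ n) + [2 ∣ n] = class n; together with
-- φ(pn) = p·φ(n) for p ∣ n and φ(pn) = (p − 1)·φ(n) for p ∤ n, this makes class completely
-- additive, by induction on the size of the product. Hence H(2x) = 1 + class x, and
-- H(px) = class p + H(x) for odd p and x ≥ 2. An element of C_k is thus 2y (y even gives A₁,
-- y odd gives A₅), an odd prime m + 1 (A₄), or px with p an odd prime factor: 3 is the only
-- odd prime of class 1 (A₂), and every other odd prime has class at least 2 (A₃).

module Submission where

open import Level using (Level)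
open import Data.List using ([]; _∷_; [_]; _++_; length; filter; map; upTo)
open import Data.List.Properties using (upTo-∷ʳ; map-++; filter-++; length-++)
open import Data.List.Relation.Unary.All using (_∷_)
open import Data.Nat
open import Data.Nat.Coprimality using (Coprime; coprime?; coprime-+; coprime-divisor; 1-coprimeTo) renaming (sym to coprime-sym)
open import Data.Nat.Divisibility
open import Data.Nat.Induction using (<-rec)
open import Data.Nat.Primality using (Prime; prime?; euclidsLemma; prime[2]; prime⇒irreducible; prime⇒nonZero; prime⇒nonTrivial; ¬prime[1]; productOfPrimes≥1)
open import Data.Nat.Primality.Factorisation using (factorise)
open import Data.Nat.Properties
open import Algebra.Properties.CommutativeSemigroup +-commutativeSemigroup using () renaming (interchange to +-interchange)
open import Data.Product using (_×_; _,_; proj₁; proj₂; ∃-syntax)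
open import Data.Sum using (_⊎_; inj₁; inj₂; map₂; [_,_]′)
open import Function.Base using (_∘_)
open import Function.Bundles using (_⇔_; mk⇔)
open import Relation.Nullary using (Dec; yes; no; ¬_; ¬?; _×-dec_; contradiction)
open import Relation.Nullary.Decidable using (toSum)
open import Relation.Unary using (Pred; Decidable; _⊆_)
open import Relation.Unary.Properties using (_∩?_; ∁?)
open import Relation.Binary.PropositionalEquality using (_≡_; _≢_; refl; sym; trans; cong; cong₂; subst; module ≡-Reasoning)

open import Defs

private variable
  ℓ : Level
  A B : Set ℓ
  P R : Pred ℕ ℓ
  i k l m n p : ℕ

-- Counting

indicator : Dec A → ℕ
indicator (yes _) = 1
indicator (no _)  = 0

indicator-cong : (A → B) → (B → A) → (a? : Dec A) (b? : Dec B) → indicator a? ≡ indicator b?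
indicator-cong f g (yes a) (yes b) = refl
indicator-cong f g (yes a) (no ¬b) = contradiction (f a) ¬b
indicator-cong f g (no ¬a) (yes b) = contradiction (g b) ¬a
indicator-cong f g (no ¬a) (no ¬b) = refl

indicator-yes : (a? : Dec A) → A → indicator a? ≡ 1
indicator-yes (yes _) _ = refl
indicator-yes (no ¬a) a = contradiction a ¬a

indicator-no : (a? : Dec A) → ¬ A → indicator a? ≡ 0
indicator-no (yes a) ¬a = contradiction a ¬a
indicator-no (no _)  _  = refl

indicator-split : (a? : Dec A) (b? : Dec B) →
                  indicator a? ≡ indicator (a? ×-dec b?) + indicator (a? ×-dec ¬? b?)
indicator-split (yes _) (yes _) = refl
indicator-split (yes _) (no _)  = refl
indicator-split (no _)  _       = refl

count : Decidable P → ℕ → ℕ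
count P? zero    = 0
count P? (suc n) = count P? n + indicator (P? (suc n))

length-filter-singleton : (P? : Decidable P) → ∀ x → length (filter P? [ x ]) ≡ indicator (P? x)
length-filter-singleton P? x with P? x
... | yes _ = refl
... | no _  = refl

length-filter-upTo : (P? : Decidable P) → ∀ n → length (filter P? (map suc (upTo n))) ≡ count P? n
length-filter-upTo P? zero    = refl
length-filter-upTo P? (suc n) = begin
  length (filter P? (map suc (upTo (suc n))))
    ≡⟨ cong (length ∘ filter P? ∘ map suc) (upTo-∷ʳ n) ⟨
  length (filter P? (map suc (upTo n ++ [ n ])))
    ≡⟨ cong (length ∘ filter P?) (map-++ suc (upTo n) [ n ]) ⟩
  length (filter P? (map suc (upTo n) ++ [ suc n ]))
    ≡⟨ cong length (filter-++ P? (map suc (upTo n)) [ suc n ]) ⟩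
  length (filter P? (map suc (upTo n)) ++ filter P? [ suc n ])
    ≡⟨ length-++ (filter P? (map suc (upTo n))) ⟩
  length (filter P? (map suc (upTo n))) + length (filter P? [ suc n ])
    ≡⟨ cong₂ _+_ (length-filter-upTo P? n) (length-filter-singleton P? (suc n)) ⟩
  count P? n + indicator (P? (suc n)) ∎
  where open ≡-Reasoning

count-cong : (P? : Decidable P) (R? : Decidable R) → P ⊆ R → R ⊆ P → ∀ n → count P? n ≡ count R? n
count-cong P? R? P⊆R R⊆P zero    = refl
count-cong P? R? P⊆R R⊆P (suc n) =
  cong₂ _+_ (count-cong P? R? P⊆R R⊆P n) (indicator-cong P⊆R R⊆P (P? (suc n)) (R? (suc n)))

count-none : (P? : Decidable P) → ∀ n → (∀ {i} → 1 ≤ i → i ≤ n → ¬ P i) → count P? n ≡ 0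
count-none P? zero    _   = refl
count-none P? (suc n) ¬P with P? (suc n)
... | yes p = contradiction p (¬P (s≤s z≤n) ≤-refl)
... | no _  = trans (+-identityʳ _) (count-none P? n (λ 1≤i i≤n → ¬P 1≤i (m≤n⇒m≤1+n i≤n)))

count≤n : (P? : Decidable P) → ∀ n → count P? n ≤ n
count≤n P? zero = z≤n
count≤n P? (suc n) with P? (suc n)
... | yes _ = subst (_≤ suc n) (+-comm 1 (count P? n)) (s≤s (count≤n P? n))
... | no _  = subst (_≤ suc n) (sym (+-identityʳ _)) (m≤n⇒m≤1+n (count≤n P? n))

count-+ : (P? : Decidable P) → ∀ m n → count P? (m + n) ≡ count P? m + count (P? ∘ (m +_)) n
count-+ P? m zero    = trans (cong (count P?) (+-identityʳ m)) (sym (+-identityʳ _))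
count-+ P? m (suc n) = begin
  count P? (m + suc n)                                            ≡⟨ cong (count P?) (+-suc m n) ⟩
  count P? (m + n) + indicator (P? (suc (m + n)))
    ≡⟨ cong (_+ indicator (P? (suc (m + n)))) (count-+ P? m n) ⟩
  count P? m + count (P? ∘ (m +_)) n + indicator (P? (suc (m + n)))
    ≡⟨ cong (λ i → count P? m + count (P? ∘ (m +_)) n + indicator (P? i)) (+-suc m n) ⟨
  count P? m + count (P? ∘ (m +_)) n + indicator (P? (m + suc n)) ≡⟨ +-assoc (count P? m) _ _ ⟩
  count P? m + count (P? ∘ (m +_)) (suc n) ∎
  where open ≡-Reasoning

count-split : (P? : Decidable P) (R? : Decidable R) →
              ∀ n → count P? n ≡ count (P? ∩? R?) n + count (P? ∩? ∁? R?) n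
count-split P? R? zero    = refl
count-split P? R? (suc n) = trans
  (cong₂ _+_ (count-split P? R? n) (indicator-split (P? (suc n)) (R? (suc n))))
  (+-interchange (count (P? ∩? R?) n) _ _ _)

count-periodic : (P? : Decidable P) → ∀ n → (∀ {i} → P (n + i) → P i) → (∀ {i} → P i → P (n + i)) →
                 ∀ q → count P? (q * n) ≡ q * count P? n
count-periodic P? n shift⁻ shift zero    = refl
count-periodic P? n shift⁻ shift (suc q) = begin
  count P? (n + q * n)                      ≡⟨ count-+ P? n (q * n) ⟩
  count P? n + count (P? ∘ (n +_)) (q * n)  ≡⟨ cong (count P? n +_) (count-cong _ P? shift⁻ shift (q * n)) ⟩
  count P? n + count P? (q * n)             ≡⟨ cong (count P? n +_) (count-periodic P? n shift⁻ shift q) ⟩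
  count P? n + q * count P? n               ∎
  where open ≡-Reasoning

count-block : (P? : Decidable P) → ∀ d .{{_ : NonZero d}} c → d ∣ c →
              count ((P? ∩? (d ∣?_)) ∘ (c +_)) d ≡ indicator (P? (c + d))
count-block P? (suc q) c d∣c = cong₂ _+_
  (count-none _ q λ 1≤r r≤q (_ , d∣c+r) →
    <⇒≱ (s≤s r≤q) (∣⇒≤ {{>-nonZero 1≤r}} (∣m+n∣m⇒∣n d∣c+r d∣c)))
  (indicator-cong proj₁ (_, ∣m∣n⇒∣m+n d∣c ∣-refl) _ (P? (c + suc q)))

count-multiples : (P? : Decidable P) → ∀ d .{{_ : NonZero d}} n →
                  count (P? ∩? (d ∣?_)) (d * n) ≡ count (P? ∘ (d *_)) n
count-multiples P? d zero    = cong (count _) (*-zeroʳ d)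
count-multiples P? d (suc n) = begin
  count (P? ∩? (d ∣?_)) (d * suc n)
    ≡⟨ cong (count _) d*[1+n]≡d*n+d ⟩
  count (P? ∩? (d ∣?_)) (d * n + d)
    ≡⟨ count-+ _ (d * n) d ⟩
  count (P? ∩? (d ∣?_)) (d * n) + count ((P? ∩? (d ∣?_)) ∘ (d * n +_)) d
    ≡⟨ cong₂ _+_ (count-multiples P? d n) (count-block P? d (d * n) (m∣m*n n)) ⟩
  count (P? ∘ (d *_)) n + indicator (P? (d * n + d))
    ≡⟨ cong (λ i → count (P? ∘ (d *_)) n + indicator (P? i)) d*[1+n]≡d*n+d ⟨
  count (P? ∘ (d *_)) (suc n) ∎
  where
  open ≡-Reasoning
  d*[1+n]≡d*n+d : d * suc n ≡ d * n + d
  d*[1+n]≡d*n+d = trans (*-suc d n) (+-comm d (d * n))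

-- Euler's totient

coprime-∣ˡ : Coprime m n → i ∣ m → Coprime i n
coprime-∣ˡ c i∣m (d∣i , d∣n) = c (∣-trans d∣i i∣m , d∣n)

coprime-∣ʳ : Coprime m n → i ∣ n → Coprime m i
coprime-∣ʳ c i∣n (d∣m , d∣i) = c (d∣m , ∣-trans d∣i i∣n)

coprime-* : Coprime i m → Coprime i n → Coprime i (m * n)
coprime-* c₁ c₂ (d∣i , d∣mn) = c₂ (d∣i , coprime-divisor (coprime-∣ˡ c₁ d∣i) d∣mn)

coprime-+⁻ : Coprime (n + i) n → Coprime i n
coprime-+⁻ c (d∣i , d∣n) = c (∣m∣n⇒∣m+n d∣n d∣i , d∣n)

∤⇒coprime : Prime p → ¬ p ∣ i → Coprime i p
∤⇒coprime pp p∤i {d} (d∣i , d∣p) with prime⇒irreducible pp d∣p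
... | inj₁ d≡1 = d≡1
... | inj₂ refl = contradiction d∣i p∤i

coprimeTo? : ∀ n → Decidable (λ i → Coprime i n)
coprimeTo? n i = coprime? i n

φ≡count : ∀ n → φ n ≡ count (coprimeTo? n) n
φ≡count n = length-filter-upTo (coprimeTo? n) n

count-coprimeTo-* : ∀ q n → count (coprimeTo? n) (q * n) ≡ q * φ n
count-coprimeTo-* q n =
  trans (count-periodic (coprimeTo? n) n coprime-+⁻ coprime-+ q) (cong (q *_) (sym (φ≡count n)))

coprime∧∣⇒∤ : Prime p → Coprime i n → p ∣ n → ¬ p ∣ i
coprime∧∣⇒∤ pp c p∣n p∣i = ¬prime[1] (subst Prime (c (p∣i , p∣n)) pp)

φ-*-∣ : Prime p → p ∣ n → φ (p * n) ≡ p * φ n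
φ-*-∣ {p} {n} pp p∣n = begin
  φ (p * n)                          ≡⟨ φ≡count (p * n) ⟩
  count (coprimeTo? (p * n)) (p * n)
    ≡⟨ count-cong (coprimeTo? (p * n)) (coprimeTo? n) weaken strengthen (p * n) ⟩
  count (coprimeTo? n) (p * n)       ≡⟨ count-coprimeTo-* p n ⟩
  p * φ n                            ∎
  where
  open ≡-Reasoning
  weaken : ∀ {i} → Coprime i (p * n) → Coprime i n
  weaken c = coprime-∣ʳ c (n∣m*n p)
  strengthen : ∀ {i} → Coprime i n → Coprime i (p * n)
  strengthen c = coprime-* (∤⇒coprime pp (coprime∧∣⇒∤ pp c p∣n)) c

φ-*-∤ : Prime p → ¬ p ∣ n → φ (p * n) ≡ pred p * φ n
φ-*-∤ {p@(suc q)} {n} pp p∤n = +-cancelʳ-≡ (φ n) (φ (p * n)) (q * φ n) (begin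
  φ (p * n) + φ n  ≡⟨ +-comm (φ (p * n)) (φ n) ⟩
  φ n + φ (p * n)  ≡⟨ cong₂ _+_ multiples nonMultiples ⟨
  count (coprimeTo? n ∩? (p ∣?_)) (p * n) + count (coprimeTo? n ∩? ∁? (p ∣?_)) (p * n)
                   ≡⟨ count-split (coprimeTo? n) (p ∣?_) (p * n) ⟨
  count (coprimeTo? n) (p * n)
                   ≡⟨ count-coprimeTo-* p n ⟩
  φ n + q * φ n    ≡⟨ +-comm (φ n) (q * φ n) ⟩
  q * φ n + φ n    ∎)
  where
  open ≡-Reasoning
  multiple-coprime⇒coprime : ∀ {j} → Coprime (p * j) n → Coprime j n
  multiple-coprime⇒coprime c = coprime-∣ˡ c (n∣m*n p)
  coprime⇒multiple-coprime : ∀ {j} → Coprime j n → Coprime (p * j) n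
  coprime⇒multiple-coprime c = coprime-sym (coprime-* (∤⇒coprime pp p∤n) (coprime-sym c))
  multiples : count (coprimeTo? n ∩? (p ∣?_)) (p * n) ≡ φ n
  multiples = begin
    count (coprimeTo? n ∩? (p ∣?_)) (p * n) ≡⟨ count-multiples (coprimeTo? n) p n ⟩
    count (coprimeTo? n ∘ (p *_)) n
      ≡⟨ count-cong (coprimeTo? n ∘ (p *_)) (coprimeTo? n)
                    multiple-coprime⇒coprime coprime⇒multiple-coprime n ⟩
    count (coprimeTo? n) n                  ≡⟨ φ≡count n ⟨
    φ n                                     ∎
  coprime∧∤⇒coprime-* : ∀ {i} → Coprime i n × ¬ p ∣ i → Coprime i (p * n)
  coprime∧∤⇒coprime-* (c , p∤i) = coprime-* (∤⇒coprime pp p∤i) c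
  coprime-*⇒coprime∧∤ : ∀ {i} → Coprime i (p * n) → Coprime i n × ¬ p ∣ i
  coprime-*⇒coprime∧∤ c = coprime-∣ʳ c (n∣m*n p) , coprime∧∣⇒∤ pp c (m∣m*n n)
  nonMultiples : count (coprimeTo? n ∩? ∁? (p ∣?_)) (p * n) ≡ φ (p * n)
  nonMultiples = begin
    count (coprimeTo? n ∩? ∁? (p ∣?_)) (p * n)
      ≡⟨ count-cong (coprimeTo? n ∩? ∁? (p ∣?_)) (coprimeTo? (p * n))
                    coprime∧∤⇒coprime-* coprime-*⇒coprime∧∤ (p * n) ⟩
    count (coprimeTo? (p * n)) (p * n) ≡⟨ φ≡count (p * n) ⟨
    φ (p * n)                          ∎

φ[p]≡p-1 : Prime p → φ p ≡ pred p
φ[p]≡p-1 {p} pp = begin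
  φ p           ≡⟨ cong φ (*-identityʳ p) ⟨
  φ (p * 1)     ≡⟨ φ-*-∤ pp (λ p∣1 → ¬prime[1] (subst Prime (∣1⇒≡1 p∣1) pp)) ⟩
  pred p * 1    ≡⟨ *-identityʳ (pred p) ⟩
  pred p        ∎
  where open ≡-Reasoning

φ>0 : 1 ≤ n → 1 ≤ φ n
φ>0 {suc m} _ = begin
  1                                  ≡⟨ indicator-yes (coprime? 1 (suc m)) (1-coprimeTo (suc m)) ⟨
  count (coprimeTo? (suc m)) 1       ≤⟨ m≤m+n _ _ ⟩
  count (coprimeTo? (suc m)) 1 + count (coprimeTo? (suc m) ∘ (1 +_)) m
                                     ≡⟨ count-+ (coprimeTo? (suc m)) 1 m ⟨
  count (coprimeTo? (suc m)) (suc m) ≡⟨ φ≡count (suc m) ⟨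
  φ (suc m)                          ∎
  where open ≤-Reasoning

φ<n : 2 ≤ n → φ n < n
φ<n {suc m} (s≤s 1≤m) = begin-strict
  φ (suc m)                                    ≡⟨ φ≡count (suc m) ⟩
  count (coprimeTo? (suc m)) m + indicator (coprime? (suc m) (suc m))
    ≡⟨ cong (count (coprimeTo? (suc m)) m +_) (indicator-no (coprime? (suc m) (suc m)) ¬coprime-self) ⟩
  count (coprimeTo? (suc m)) m + 0             ≡⟨ +-identityʳ _ ⟩
  count (coprimeTo? (suc m)) m                 ≤⟨ count≤n _ m ⟩
  m                                            <⟨ n<1+n m ⟩
  suc m                                        ∎
  where
  open ≤-Reasoning
  ¬coprime-self : ¬ Coprime (suc m) (suc m)
  ¬coprime-self c = <⇒≢ (s≤s 1≤m) (sym (c (∣-refl , ∣-refl)))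

-- Parity and prime factors

even⊎even-suc : ∀ n → Even n ⊎ Even (suc n)
even⊎even-suc zero    = inj₁ (2 ∣0)
even⊎even-suc (suc n) with even⊎even-suc n
... | inj₁ 2∣n   = inj₂ (∣m∣n⇒∣m+n ∣-refl 2∣n)
... | inj₂ 2∣1+n = inj₁ 2∣1+n

even⊎odd : ∀ n → Even n ⊎ Odd n
even⊎odd n = toSum (2 ∣? n)

even⇒odd-suc : Even n → Odd (suc n)
even⇒odd-suc {n} 2∣n 2∣1+n =
  contradiction (∣1⇒≡1 (∣m+n∣m⇒∣n (subst (2 ∣_) (+-comm 1 n) 2∣1+n) 2∣n)) λ ()

odd⇒even-pred : Odd n → Even (pred n)
odd⇒even-pred {zero}  odd = contradiction (2 ∣0) odd
odd⇒even-pred {suc n} odd with even⊎even-suc n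
... | inj₁ 2∣n   = 2∣n
... | inj₂ 2∣1+n = contradiction 2∣1+n odd

odd-* : Odd m → Odd n → Odd (m * n)
odd-* {m} {n} odd-m odd-n 2∣mn with euclidsLemma m n prime[2] 2∣mn
... | inj₁ 2∣m = odd-m 2∣m
... | inj₂ 2∣n = odd-n 2∣n

even-prime⇒≡2 : Prime p → Even p → p ≡ 2
even-prime⇒≡2 pp 2∣p with prime⇒irreducible pp 2∣p
... | inj₂ 2≡p = sym 2≡p

indicator-even-*-absorb : (Even m → Even n) → indicator (2 ∣? (m * n)) ≡ indicator (2 ∣? n)
indicator-even-*-absorb {m} {n} even⇒even =
  indicator-cong even[mn]⇒even[n] (∣n⇒∣m*n m) (2 ∣? (m * n)) (2 ∣? n)
  where
  even[mn]⇒even[n] : Even (m * n) → Even n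
  even[mn]⇒even[n] 2∣mn with euclidsLemma m n prime[2] 2∣mn
  ... | inj₁ 2∣m = even⇒even 2∣m
  ... | inj₂ 2∣n = 2∣n

indicator-even-* : ¬ (Even m × Even n) →
                   indicator (2 ∣? (m * n)) ≡ indicator (2 ∣? m) + indicator (2 ∣? n)
indicator-even-* {m} {n} ¬both with 2 ∣? m | 2 ∣? n
... | yes 2∣m  | yes 2∣n  = contradiction (2∣m , 2∣n) ¬both
... | yes 2∣m  | no _     = indicator-yes (2 ∣? (m * n)) (∣m⇒∣m*n n 2∣m)
... | no _     | yes 2∣n  = indicator-yes (2 ∣? (m * n)) (∣n⇒∣m*n m 2∣n)
... | no odd-m | no odd-n = indicator-no (2 ∣? (m * n)) (odd-* odd-m odd-n)

primeFactor : 2 ≤ n → ∃[ p ] ∃[ x ] (Prime p × 1 ≤ x × n ≡ p * x)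
primeFactor {n} 2≤n with factorise n {{>-nonZero (<-trans z<s 2≤n)}}
... | record { factors = [] ; isFactorisation = n≡1 } = contradiction n≡1 (>⇒≢ 2≤n)
... | record { factors = p ∷ ps ; isFactorisation = n≡p*x ; factorsPrime = pp ∷ ps-prime } =
  p , _ , pp , productOfPrimes≥1 ps-prime , n≡p*x

prime⇒2≤ : Prime p → 2 ≤ p
prime⇒2≤ {p} pp = nonTrivial⇒n>1 p {{prime⇒nonTrivial pp}}

n<p*n : Prime p → 1 ≤ n → n < p * n
n<p*n {p} {n} pp 1≤n = subst (n <_) (*-comm n p) (m<m*n n p {{>-nonZero 1≤n}} (prime⇒2≤ pp))

odd∧2≤⇒3≤ : Odd n → 2 ≤ n → 3 ≤ n
odd∧2≤⇒3≤ odd 2≤n = ≤∧≢⇒< 2≤n (λ 2≡n → odd (subst (2 ∣_) 2≡n ∣-refl))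

φ-even : ∀ n → 3 ≤ n → Even (φ n)
φ-even = <-rec (λ n → 3 ≤ n → Even (φ n)) step
  where
  step : ∀ n → (∀ {y} → y < n → 3 ≤ y → Even (φ y)) → 3 ≤ n → Even (φ n)
  step n rec 3≤n with primeFactor (<⇒≤ 3≤n)
  ... | p , x , pp , 1≤x , refl with 2 ∣? p | p ∣? x
  ...   | yes 2∣p | yes p∣x = subst Even (sym (φ-*-∣ pp p∣x)) (∣m⇒∣m*n (φ x) 2∣p)
  ...   | no odd-p | no p∤x = subst Even (sym (φ-*-∤ pp p∤x)) (∣m⇒∣m*n (φ x) (odd⇒even-pred odd-p))
  ...   | no odd-p | yes p∣x = subst Even (sym (φ-*-∣ pp p∣x)) (∣n⇒∣m*n p (rec (n<p*n pp 1≤x) 3≤x))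
    where
    3≤x : 3 ≤ x
    3≤x = ≤-trans (odd∧2≤⇒3≤ odd-p (prime⇒2≤ pp)) (∣⇒≤ {{>-nonZero 1≤x}} p∣x)
  ...   | yes 2∣p | no p∤x with even-prime⇒≡2 pp 2∣p
  ...     | refl = subst Even (sym (trans (φ-*-∤ pp p∤x) (*-identityˡ (φ x)))) (rec (n<p*n pp 1≤x) 3≤x)
    where
    3≤2*x⇒2≤x : ∀ x → 3 ≤ 2 * x → 2 ≤ x
    3≤2*x⇒2≤x (suc zero)    (s≤s (s≤s ()))
    3≤2*x⇒2≤x (suc (suc _)) _ = s≤s (s≤s z≤n)
    3≤x : 3 ≤ x
    3≤x = odd∧2≤⇒3≤ p∤x (3≤2*x⇒2≤x x 3≤n)

2≤φ : 3 ≤ n → 2 ≤ φ n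
2≤φ {n} 3≤n = ≤∧≢⇒< (φ>0 {n} (<⇒≤ (<⇒≤ 3≤n)))
  (λ 1≡φn → even⇒odd-suc (2 ∣0) (subst Even (sym 1≡φn) (φ-even n 3≤n)))

-- The height function

HasHeight⇒1≤ : HasHeight n k → 1 ≤ n
HasHeight⇒1≤ h-one          = s≤s z≤n
HasHeight⇒1≤ (h-step 2≤n _) = <⇒≤ 2≤n

HasHeight⇒2≤ : HasHeight n k → 1 ≤ k → 2 ≤ n
HasHeight⇒2≤ (h-step 2≤n _) _ = 2≤n

HasHeight-functional : HasHeight n k → HasHeight n l → k ≡ l
HasHeight-functional h-one            h-one            = refl
HasHeight-functional h-one            (h-step (s≤s ()) _)
HasHeight-functional (h-step (s≤s ()) _) h-one
HasHeight-functional (h-step _ hk)    (h-step _ hl)    = cong suc (HasHeight-functional hk hl)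

hasHeight : ∀ n → 1 ≤ n → ∃[ k ] HasHeight n k
hasHeight = <-rec (λ n → 1 ≤ n → ∃[ k ] HasHeight n k) step
  where
  step : ∀ n → (∀ {m} → m < n → 1 ≤ m → ∃[ k ] HasHeight m k) → 1 ≤ n → ∃[ k ] HasHeight n k
  step (suc zero)          _   _ = 0 , h-one
  step n@(suc (suc _)) rec _ with rec (φ<n {n} (s≤s (s≤s z≤n))) (φ>0 {n} (s≤s z≤n))
  ... | k , hk = suc k , h-step (s≤s (s≤s z≤n)) hk

height : ℕ → ℕ
height zero        = 0
height n@(suc _)   = proj₁ (hasHeight n (s≤s z≤n))

HasHeight-height : 1 ≤ n → HasHeight n (height n)
HasHeight-height {suc m} _ = proj₂ (hasHeight (suc m) (s≤s z≤n))

HasHeight⇒height≡ : HasHeight n k → height n ≡ k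
HasHeight⇒height≡ hk = HasHeight-functional (HasHeight-height (HasHeight⇒1≤ hk)) hk

height≡⇒HasHeight : 1 ≤ n → height n ≡ k → HasHeight n k
height≡⇒HasHeight 1≤n refl = HasHeight-height 1≤n

height[1]≡0 : height 1 ≡ 0
height[1]≡0 = HasHeight⇒height≡ h-one

height-φ : 2 ≤ n → height n ≡ suc (height (φ n))
height-φ 2≤n = HasHeight⇒height≡ (h-step 2≤n (HasHeight-height (φ>0 (<⇒≤ 2≤n))))

height>0 : 2 ≤ n → 1 ≤ height n
height>0 2≤n = subst (1 ≤_) (sym (height-φ 2≤n)) (s≤s z≤n)

-- Shapiro's class

class : ℕ → ℕ
class n with 2 ∣? n
... | yes _ = height n
... | no _  = pred (height n)

class-even : Even n → class n ≡ height n
class-even {n} 2∣n with 2 ∣? n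
... | yes _  = refl
... | no odd = contradiction 2∣n odd

class-odd : Odd n → 2 ≤ n → suc (class n) ≡ height n
class-odd {n} odd 2≤n with 2 ∣? n
... | yes 2∣n = contradiction 2∣n odd
... | no _    = trans (cong (λ h → suc (pred h)) (height-φ 2≤n)) (sym (height-φ 2≤n))

class[1]≡0 : class 1 ≡ 0
class[1]≡0 = cong pred height[1]≡0

class[2]≡1 : class 2 ≡ 1
class[2]≡1 = trans (class-even ∣-refl) (trans (height-φ {2} (s≤s (s≤s z≤n))) (cong suc height[1]≡0))

class-φ : 2 ≤ n → class (φ n) + indicator (2 ∣? n) ≡ class n
class-φ {1}                     (s≤s ())
class-φ {2}                     _   = trans (cong (_+ 1) class[1]≡0) (sym class[2]≡1)
class-φ {n@(suc (suc (suc _)))} 2≤n with 2 ∣? n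
... | yes _ = begin
  class (φ n) + 1    ≡⟨ cong (_+ 1) (class-even (φ-even n (s≤s (s≤s (s≤s z≤n))))) ⟩
  height (φ n) + 1   ≡⟨ +-comm (height (φ n)) 1 ⟩
  suc (height (φ n)) ≡⟨ height-φ 2≤n ⟨
  height n           ∎
  where open ≡-Reasoning
... | no _ = begin
  class (φ n) + 0          ≡⟨ +-identityʳ (class (φ n)) ⟩
  class (φ n)              ≡⟨ class-even (φ-even n (s≤s (s≤s (s≤s z≤n)))) ⟩
  height (φ n)             ≡⟨ cong pred (height-φ 2≤n) ⟨
  pred (height n)          ∎
  where open ≡-Reasoning

class-φ-odd : Odd n → 2 ≤ n → class (φ n) ≡ class n
class-φ-odd {n} odd 2≤n = begin
  class (φ n)                       ≡⟨ +-identityʳ (class (φ n)) ⟨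
  class (φ n) + 0                   ≡⟨ cong (class (φ n) +_) (indicator-no (2 ∣? n) odd) ⟨
  class (φ n) + indicator (2 ∣? n)  ≡⟨ class-φ 2≤n ⟩
  class n                           ∎
  where open ≡-Reasoning

-- For p ∤ n the prime case needs additivity at (p − 1)·φ(n), which is not a multiple of p;
-- hence the induction runs over the size of the product.
AdditiveBelow : ℕ → Set
AdditiveBelow N = ∀ {a b} → 1 ≤ a → 1 ≤ b → a * b < N → class (a * b) ≡ class a + class b

class-*-prime : ∀ {p} → Prime p → 1 ≤ n → AdditiveBelow (p * n) → class (p * n) ≡ class p + class n
class-*-prime {1} {p} _ _ _ = begin
  class (p * 1)     ≡⟨ cong class (*-identityʳ p) ⟩
  class p           ≡⟨ +-identityʳ (class p) ⟨
  class p + 0       ≡⟨ cong (class p +_) class[1]≡0 ⟨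
  class p + class 1 ∎
  where open ≡-Reasoning
class-*-prime {n@(suc (suc _))} {p} pp _ additive = begin
  class (p * n)                                ≡⟨ class-φ 2≤pn ⟨
  class (φ (p * n)) + indicator (2 ∣? (p * n)) ≡⟨ split (p ∣? n) ⟩
  class p + class n                            ∎
  where
  open ≡-Reasoning
  instance _ = prime⇒nonZero pp
  2≤n : 2 ≤ n
  2≤n = s≤s (s≤s z≤n)
  2≤pn : 2 ≤ p * n
  2≤pn = ≤-trans 2≤n (m≤n*m n p)
  split : Dec (p ∣ n) → class (φ (p * n)) + indicator (2 ∣? (p * n)) ≡ class p + class n
  split (yes p∣n) = begin
    class (φ (p * n)) + indicator (2 ∣? (p * n))
      ≡⟨ cong₂ _+_ (cong class (φ-*-∣ pp p∣n)) (indicator-even-*-absorb even[p]⇒even[n]) ⟩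
    class (p * φ n) + indicator (2 ∣? n)
      ≡⟨ cong (_+ indicator (2 ∣? n)) (additive (<⇒≤ (prime⇒2≤ pp)) (φ>0 {n} (s≤s z≤n)) p*φn<p*n) ⟩
    class p + class (φ n) + indicator (2 ∣? n)
      ≡⟨ +-assoc (class p) _ _ ⟩
    class p + (class (φ n) + indicator (2 ∣? n))
      ≡⟨ cong (class p +_) (class-φ 2≤n) ⟩
    class p + class n ∎
    where
    p*φn<p*n : p * φ n < p * n
    p*φn<p*n = *-monoʳ-< p (φ<n {n} 2≤n)
    even[p]⇒even[n] : Even p → Even n
    even[p]⇒even[n] 2∣p = subst (_∣ n) (even-prime⇒≡2 pp 2∣p) p∣n
  split (no p∤n) = begin
    class (φ (p * n)) + indicator (2 ∣? (p * n))
      ≡⟨ cong₂ _+_ (cong class (φ-*-∤ pp p∤n)) (indicator-even-* ¬both-even) ⟩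
    class (pred p * φ n) + (indicator (2 ∣? p) + indicator (2 ∣? n))
      ≡⟨ cong (_+ (indicator (2 ∣? p) + indicator (2 ∣? n)))
              (additive 1≤pred[p] (φ>0 {n} (s≤s z≤n)) pred[p]*φn<p*n) ⟩
    (class (pred p) + class (φ n)) + (indicator (2 ∣? p) + indicator (2 ∣? n))
      ≡⟨ +-interchange (class (pred p)) _ _ _ ⟩
    (class (pred p) + indicator (2 ∣? p)) + (class (φ n) + indicator (2 ∣? n))
      ≡⟨ cong (λ m → class m + indicator (2 ∣? p) + _) (φ[p]≡p-1 pp) ⟨
    (class (φ p) + indicator (2 ∣? p)) + (class (φ n) + indicator (2 ∣? n))
      ≡⟨ cong₂ _+_ (class-φ (prime⇒2≤ pp)) (class-φ 2≤n) ⟩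
    class p + class n ∎
    where
    ¬both-even : ¬ (Even p × Even n)
    ¬both-even (2∣p , 2∣n) = p∤n (subst (_∣ n) (sym (even-prime⇒≡2 pp 2∣p)) 2∣n)
    1≤pred[p] : 1 ≤ pred p
    1≤pred[p] = pred-mono-≤ (prime⇒2≤ pp)
    pred[p]*φn<p*n : pred p * φ n < p * n
    pred[p]*φn<p*n = ≤-<-trans (*-monoʳ-≤ (pred p) (<⇒≤ (φ<n {n} 2≤n)))
                               (*-monoˡ-< n (subst (pred p <_) (suc-pred p) (n<1+n (pred p))))

AdditiveBelow-mono : ∀ {M N} → M ≤ N → AdditiveBelow N → AdditiveBelow M
AdditiveBelow-mono M≤N additive 1≤a 1≤b ab<M = additive 1≤a 1≤b (<-≤-trans ab<M M≤N)

class-*-step : ∀ {a b} → 1 ≤ a → 1 ≤ b → AdditiveBelow (a * b) → class (a * b) ≡ class a + class b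
class-*-step {1}              {b} _ _   _        = cong class (*-identityˡ b)
class-*-step {a@(suc (suc _))} {b} _ 1≤b additive with primeFactor {a} (s≤s (s≤s z≤n))
... | p , x , pp , 1≤x , a≡p*x = begin
  class (a * b)             ≡⟨ cong class a*b≡p*[x*b] ⟩
  class (p * (x * b))       ≡⟨ class-*-prime pp 1≤x*b (AdditiveBelow-mono (≤-reflexive (sym a*b≡p*[x*b])) additive) ⟩
  class p + class (x * b)   ≡⟨ cong (class p +_) (additive 1≤x 1≤b (*-monoˡ-< b x<a)) ⟩
  class p + (class x + class b) ≡⟨ +-assoc (class p) (class x) (class b) ⟨
  (class p + class x) + class b ≡⟨ cong (_+ class b) (class-*-prime pp 1≤x (AdditiveBelow-mono p*x≤a*b additive)) ⟨
  class (p * x) + class b   ≡⟨ cong (λ m → class m + class b) a≡p*x ⟨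
  class a + class b         ∎
  where
  open ≡-Reasoning
  instance _ = >-nonZero 1≤b
  a*b≡p*[x*b] : a * b ≡ p * (x * b)
  a*b≡p*[x*b] = trans (cong (_* b) a≡p*x) (*-assoc p x b)
  1≤x*b : 1 ≤ x * b
  1≤x*b = ≤-trans 1≤x (m≤m*n x b)
  x<a : x < a
  x<a = subst (x <_) (sym a≡p*x) (n<p*n pp 1≤x)
  p*x≤a*b : p * x ≤ a * b
  p*x≤a*b = subst (_≤ a * b) a≡p*x (m≤m*n a b)

class-*-below : ∀ N → AdditiveBelow N
class-*-below zero    _   _   ()
class-*-below (suc N) 1≤a 1≤b (s≤s ab≤N) =
  class-*-step 1≤a 1≤b (AdditiveBelow-mono ab≤N (class-*-below N))

class-* : ∀ {a b} → 1 ≤ a → 1 ≤ b → class (a * b) ≡ class a + class b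
class-* {a} {b} 1≤a 1≤b = class-*-below (suc (a * b)) 1≤a 1≤b ≤-refl

height[2]≡1 : height 2 ≡ 1
height[2]≡1 = trans (sym (class-even ∣-refl)) class[2]≡1

class[3]≡1 : class 3 ≡ 1
class[3]≡1 = trans (sym (class-φ {3} (s≤s (s≤s z≤n)))) class[2]≡1

height-2* : 1 ≤ n → height (2 * n) ≡ suc (class n)
height-2* {n} 1≤n = begin
  height (2 * n)      ≡⟨ class-even (∣m⇒∣m*n n ∣-refl) ⟨
  class (2 * n)       ≡⟨ class-* {2} (s≤s z≤n) 1≤n ⟩
  class 2 + class n   ≡⟨ cong (_+ class n) class[2]≡1 ⟩
  suc (class n)       ∎
  where open ≡-Reasoning

height-*-odd : Odd m → 1 ≤ m → 2 ≤ n → height (m * n) ≡ class m + height n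
height-*-odd {m} {n} odd-m 1≤m 2≤n with 2 ∣? n
... | yes 2∣n = begin
  height (m * n)    ≡⟨ class-even (∣n⇒∣m*n m 2∣n) ⟨
  class (m * n)     ≡⟨ class-* 1≤m (<⇒≤ 2≤n) ⟩
  class m + class n ≡⟨ cong (class m +_) (class-even 2∣n) ⟩
  class m + height n ∎
  where open ≡-Reasoning
... | no odd-n = begin
  height (m * n)          ≡⟨ class-odd (odd-* odd-m odd-n) (≤-trans 2≤n (m≤n*m n m {{>-nonZero 1≤m}})) ⟨
  suc (class (m * n))     ≡⟨ cong suc (class-* 1≤m (<⇒≤ 2≤n)) ⟩
  suc (class m + class n) ≡⟨ +-suc (class m) (class n) ⟨
  class m + suc (class n) ≡⟨ cong (class m +_) (class-odd odd-n 2≤n) ⟩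
  class m + height n      ∎
  where open ≡-Reasoning

height-prime : Prime p → height p ≡ suc (height (pred p))
height-prime pp = trans (height-φ (prime⇒2≤ pp)) (cong (suc ∘ height) (φ[p]≡p-1 pp))

class>0 : 2 ≤ n → 1 ≤ class n
class>0 {n} 2≤n with even⊎odd n
... | inj₁ 2∣n  = subst (1 ≤_) (sym (class-even 2∣n)) (height>0 2≤n)
... | inj₂ odd-n = subst (1 ≤_) height[φn]≡class[n] (height>0 (2≤φ 3≤n))
  where
  3≤n = odd∧2≤⇒3≤ odd-n 2≤n
  height[φn]≡class[n] : height (φ n) ≡ class n
  height[φn]≡class[n] = trans (sym (class-even (φ-even n 3≤n))) (class-φ-odd odd-n 2≤n)

2≤class-odd-prime : Prime p → Odd p → p ≢ 3 → 2 ≤ class p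
2≤class-odd-prime {p} pp odd-p p≢3 with odd⇒even-pred odd-p
... | divides 0 pred[p]≡0 = contradiction pred[p]≡0 (>⇒≢ (pred-mono-≤ (prime⇒2≤ pp)))
... | divides 1 pred[p]≡2 =
  contradiction (trans (sym (suc-pred p {{prime⇒nonZero pp}})) (cong suc pred[p]≡2)) p≢3
... | divides r@(suc (suc _)) pred[p]≡r*2 = begin
  2                   ≤⟨ s≤s (class>0 {r} (s≤s (s≤s z≤n))) ⟩
  suc (class r)       ≡⟨ +-comm 1 (class r) ⟩
  class r + 1         ≡⟨ cong (class r +_) class[2]≡1 ⟨
  class r + class 2   ≡⟨ class-* {r} {2} (s≤s z≤n) (s≤s z≤n) ⟨
  class (r * 2)       ≡⟨ cong class pred[p]≡r*2 ⟨
  class (pred p)      ≡⟨ cong class (φ[p]≡p-1 pp) ⟨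
  class (φ p)         ≡⟨ class-φ-odd odd-p (prime⇒2≤ pp) ⟩
  class p             ∎
  where open ≤-Reasoning

-- The decomposition of C_k

odd[3] : Odd 3
odd[3] = even⇒odd-suc {2} ∣-refl

A₁⊆C : 1 ≤ k → A₁ k n → C k n
A₁⊆C {suc k} _ (x , Cx , 2∣x , refl) = height≡⇒HasHeight (≤-trans 1≤x (m≤n*m x 2)) (begin
  height (2 * x)  ≡⟨ height-2* 1≤x ⟩
  suc (class x)   ≡⟨ cong suc (class-even 2∣x) ⟩
  suc (height x)  ≡⟨ cong suc (HasHeight⇒height≡ Cx) ⟩
  suc k           ∎)
  where
  open ≡-Reasoning
  1≤x = HasHeight⇒1≤ Cx

A₂⊆C : 2 ≤ k → A₂ k n → C k n
A₂⊆C {suc k} (s≤s 1≤k) (x , Cx , odd-x , refl) = height≡⇒HasHeight (≤-trans 1≤x (m≤n*m x 3)) (begin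
  height (3 * x)     ≡⟨ height-*-odd odd[3] (s≤s z≤n) (HasHeight⇒2≤ Cx 1≤k) ⟩
  class 3 + height x ≡⟨ cong₂ _+_ class[3]≡1 (HasHeight⇒height≡ Cx) ⟩
  suc k              ∎)
  where
  open ≡-Reasoning
  1≤x = HasHeight⇒1≤ Cx

A₃⊆C : A₃ k n → C k n
A₃⊆C {zero}  (_ , _ , _ , 2≤k₁ , k₁≤0 , _) = contradiction (≤-trans 2≤k₁ k₁≤0) λ ()
A₃⊆C {suc k} (k₁ , x , p , 2≤k₁ , k₁≤k , Cx , (pp , Cp) , refl) = height≡⇒HasHeight 1≤p*x (begin
  height (p * x)           ≡⟨ height-*-odd odd-p (<⇒≤ (prime⇒2≤ pp)) 2≤x ⟩
  class p + height x       ≡⟨ cong₂ _+_ class[p]≡k₁ (HasHeight⇒height≡ Cx) ⟩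
  k₁ + (suc k ∸ k₁)        ≡⟨ m+[n∸m]≡n (m≤n⇒m≤1+n k₁≤k) ⟩
  suc k                    ∎)
  where
  open ≡-Reasoning
  2≤x : 2 ≤ x
  2≤x = HasHeight⇒2≤ Cx (m<n⇒0<n∸m (s≤s k₁≤k))
  1≤p*x : 1 ≤ p * x
  1≤p*x = ≤-trans (<⇒≤ 2≤x) (m≤n*m x p {{prime⇒nonZero pp}})
  height[p]≡k₁+1 : height p ≡ k₁ + 1
  height[p]≡k₁+1 = HasHeight⇒height≡ Cp
  odd-p : Odd p
  odd-p 2∣p with even-prime⇒≡2 pp 2∣p
  ... | refl = <⇒≢ (≤-trans 2≤k₁ (m≤m+n k₁ 1)) (trans (sym height[2]≡1) height[p]≡k₁+1)
  class[p]≡k₁ : class p ≡ k₁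
  class[p]≡k₁ =
    suc-injective (trans (class-odd odd-p (prime⇒2≤ pp)) (trans height[p]≡k₁+1 (+-comm k₁ 1)))

A₄⊆C : 1 ≤ k → A₄ k n → C k n
A₄⊆C {suc k} _ (m , Cm , _ , pp , refl) = height≡⇒HasHeight (m≤n+m 1 m) (begin
  height (m + 1)              ≡⟨ height-prime pp ⟩
  suc (height (pred (m + 1))) ≡⟨ cong (suc ∘ height ∘ pred) (+-comm m 1) ⟩
  suc (height m)              ≡⟨ cong suc (HasHeight⇒height≡ Cm) ⟩
  suc k                       ∎)
  where
  open ≡-Reasoning

A₁₋₄⊆C : 2 ≤ k → A₁₋₄ k n → C k n
A₁₋₄⊆C 2≤k (inj₁ a)               = A₁⊆C (<⇒≤ 2≤k) a
A₁₋₄⊆C 2≤k (inj₂ (inj₁ a))        = A₂⊆C 2≤k a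
A₁₋₄⊆C 2≤k (inj₂ (inj₂ (inj₁ a))) = A₃⊆C a
A₁₋₄⊆C 2≤k (inj₂ (inj₂ (inj₂ a))) = A₄⊆C (<⇒≤ 2≤k) a

A₅⊆C : 2 ≤ k → A₅ k n → C k n
A₅⊆C {k} 2≤k (y , Ay , odd-y , refl) = height≡⇒HasHeight (≤-trans (<⇒≤ 2≤y) (m≤n*m y 2)) (begin
  height (2 * y) ≡⟨ height-2* (<⇒≤ 2≤y) ⟩
  suc (class y)  ≡⟨ class-odd odd-y 2≤y ⟩
  height y       ≡⟨ HasHeight⇒height≡ Cy ⟩
  k              ∎)
  where
  open ≡-Reasoning
  Cy = A₁₋₄⊆C 2≤k Ay
  2≤y = HasHeight⇒2≤ Cy (<⇒≤ 2≤k)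

odd-composite-C⊆A₂₋₃ : ∀ {p x} → Prime p → 2 ≤ x → Odd (p * x) → C (suc k) (p * x) →
                       A₂ (suc k) (p * x) ⊎ A₃ (suc k) (p * x)
odd-composite-C⊆A₂₋₃ {k} {p} {x} pp 2≤x odd-px Cpx = split (p ≟ 3)
  where
  2≤p = prime⇒2≤ pp
  1≤x = <⇒≤ 2≤x
  odd-p : Odd p
  odd-p 2∣p = odd-px (∣m⇒∣m*n x 2∣p)
  odd-x : Odd x
  odd-x 2∣x = odd-px (∣n⇒∣m*n p 2∣x)
  class[p]+height[x]≡1+k : class p + height x ≡ suc k
  class[p]+height[x]≡1+k = trans (sym (height-*-odd odd-p (<⇒≤ 2≤p) 2≤x)) (HasHeight⇒height≡ Cpx)
  split : Dec (p ≡ 3) → A₂ (suc k) (p * x) ⊎ A₃ (suc k) (p * x)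
  split (yes p≡3) = inj₁ (x , height≡⇒HasHeight 1≤x height[x]≡k , odd-x , cong (_* x) p≡3)
    where
    height[x]≡k : height x ≡ k
    height[x]≡k = suc-injective (begin
      suc (height x)     ≡⟨ cong (_+ height x) class[3]≡1 ⟨
      class 3 + height x ≡⟨ cong (λ q → class q + height x) p≡3 ⟨
      class p + height x ≡⟨ class[p]+height[x]≡1+k ⟩
      suc k              ∎)
      where open ≡-Reasoning
  split (no p≢3) =
    inj₂ (class p , x , p , 2≤class-odd-prime pp odd-p p≢3 , class[p]≤k , Cx , (pp , Cp) , refl)
    where
    class[p]≤k : class p ≤ k
    class[p]≤k = m+n≤o⇒m≤o∸n (class p)
      (≤-trans (+-monoʳ-≤ (class p) (height>0 2≤x)) (≤-reflexive class[p]+height[x]≡1+k))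
    Cx : C (suc k ∸ class p) x
    Cx = height≡⇒HasHeight 1≤x
      (sym (trans (cong (_∸ class p) (sym class[p]+height[x]≡1+k)) (m+n∸m≡n (class p) (height x))))
    Cp : HasHeight p (class p + 1)
    Cp = height≡⇒HasHeight (<⇒≤ 2≤p) (trans (sym (class-odd odd-p 2≤p)) (+-comm 1 (class p)))

odd-C⊆A₂₋₄ : 2 ≤ k → Odd n → C k n → A₂ k n ⊎ A₃ k n ⊎ A₄ k n
odd-C⊆A₂₋₄ {suc k} {n} _ odd-n Cn with prime? n
... | yes pn =
  inj₂ (inj₂ (pred n , Cpred[n] , odd⇒even-pred odd-n , subst Prime n≡pred[n]+1 pn , n≡pred[n]+1))
  where
  2≤n = HasHeight⇒2≤ Cn (s≤s z≤n)
  n≡pred[n]+1 : n ≡ pred n + 1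
  n≡pred[n]+1 = trans (sym (suc-pred n {{>-nonZero (<⇒≤ 2≤n)}})) (+-comm 1 (pred n))
  Cpred[n] : C k (pred n)
  Cpred[n] = height≡⇒HasHeight (pred-mono-≤ 2≤n)
    (suc-injective (trans (sym (height-prime pn)) (HasHeight⇒height≡ Cn)))
... | no ¬pn with primeFactor (HasHeight⇒2≤ Cn (s≤s z≤n))
...   | p , x , pp , 1≤x , refl = map₂ inj₁ (odd-composite-C⊆A₂₋₃ pp 2≤x odd-n Cn)
  where
  2≤x : 2 ≤ x
  2≤x = ≤∧≢⇒< 1≤x (λ 1≡x → ¬pn (subst Prime (trans (sym (*-identityʳ p)) (cong (p *_) 1≡x)) pp))

even-C⊆A₁⊎A₅ : ∀ {y} → 2 ≤ k → C k n → n ≡ 2 * y → A₁ k n ⊎ A₅ k n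
even-C⊆A₁⊎A₅ {y = zero}      _   Cn refl = contradiction (HasHeight⇒1≤ Cn) λ ()
even-C⊆A₁⊎A₅ {suc k} {y = y@(suc _)} 2≤1+k C2y refl = split (even⊎odd y)
  where
  1≤y : 1 ≤ y
  1≤y = s≤s z≤n
  class[y]≡k : class y ≡ k
  class[y]≡k = suc-injective (trans (sym (height-2* 1≤y)) (HasHeight⇒height≡ C2y))
  split : Even y ⊎ Odd y → A₁ (suc k) (2 * y) ⊎ A₅ (suc k) (2 * y)
  split (inj₁ 2∣y)   =
    inj₁ (y , height≡⇒HasHeight 1≤y (trans (sym (class-even 2∣y)) class[y]≡k) , 2∣y , refl)
  split (inj₂ odd-y) =
    inj₂ (y , inj₂ (odd-C⊆A₂₋₄ 2≤1+k odd-y Cy) , odd-y , refl)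
    where
    2≤y : 2 ≤ y
    2≤y = ≤∧≢⇒< 1≤y λ 1≡y →
      <⇒≢ 2≤1+k (cong suc (trans (sym class[1]≡0) (trans (cong class 1≡y) class[y]≡k)))
    Cy : C (suc k) y
    Cy = height≡⇒HasHeight 1≤y (trans (sym (class-odd odd-y 2≤y)) (cong suc class[y]≡k))

C⊆A₁₋₅ : 2 ≤ k → C k n → A₁ k n ⊎ A₂ k n ⊎ A₃ k n ⊎ A₄ k n ⊎ A₅ k n
C⊆A₁₋₅ {k} {n} 2≤k Cn with even⊎odd n
... | inj₁ 2∣n   = [ inj₁ , inj₂ ∘ inj₂ ∘ inj₂ ∘ inj₂ ]′
                     (even-C⊆A₁⊎A₅ {y = quotient 2∣n} 2≤k Cn (m∣n⇒n≡m*quotient 2∣n))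
... | inj₂ odd-n = inj₂ (map₂ (map₂ inj₁) (odd-C⊆A₂₋₄ 2≤k odd-n Cn))

A₁₋₅⊆C : 2 ≤ k → A₁ k n ⊎ A₂ k n ⊎ A₃ k n ⊎ A₄ k n ⊎ A₅ k n → C k n
A₁₋₅⊆C 2≤k (inj₁ a)                      = A₁⊆C (<⇒≤ 2≤k) a
A₁₋₅⊆C 2≤k (inj₂ (inj₁ a))               = A₂⊆C 2≤k a
A₁₋₅⊆C 2≤k (inj₂ (inj₂ (inj₁ a)))        = A₃⊆C a
A₁₋₅⊆C 2≤k (inj₂ (inj₂ (inj₂ (inj₁ a)))) = A₄⊆C (<⇒≤ 2≤k) a
A₁₋₅⊆C 2≤k (inj₂ (inj₂ (inj₂ (inj₂ a)))) = A₅⊆C 2≤k a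

theorem2p3 : (k : ℕ) → 2 ≤ k → (n : ℕ) →
    C k n ⇔ (A₁ k n ⊎ A₂ k n ⊎ A₃ k n ⊎ A₄ k n ⊎ A₅ k n)
theorem2p3 k 2≤k n = mk⇔ (C⊆A₁₋₅ 2≤k) (A₁₋₅⊆C 2≤k)
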